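{- Let $T_0<\dots<T_{r-1}$ be positive integers with $T_k=b_kT_{k-1}$ for integers $b_k\ge 2$; put $w=T_0$, $\mathbf b=(b_1,\dots,b_{r-1})$, $B_k=\prod_{m=1}^kb_m$ ($B_0=1$), $H=B_{r-1}$. Let $I$ be an instance with jobs $J_1,\dots,J_n$, job $J_i$ having positive integer processing time $p_i$ and period $T_{\pi_i}$, $\pi_i\in\{0,\dots,r-1\}$. Let $\phi(I)$ be the height-divisible 2D packing instance with a bin of width $w$ and height $H$ and rectangles $R_1,\dots,R_n$, where $R_i$ has width $\ell_i=p_i$ and height $h_i=T_{r-1}/T_{\pi_i}=H/B_{\pi_i}$. (i) If $(u_i,v_i)_{i}$ is a feasible (collision-free) periodic schedule of $I$, then setting $x_i=u_i$ and $y_i=h_i\cdot\mathrm{flip}(v_i,\pi_i,\mathbf b)$ for all $i$ gives a feasible height-divisible packing of $\phi(I)$. (ii) Conversely, if $(x_i,y_i)_i$ is a feasible height-divisible packing of $\phi(I)$, then setting $u_i=x_i$ and $v_i=\mathrm{flip}(y_i/h_i,\pi_i,\mathrm{bflip}(\mathbf b,\pi_i))$ for all $i$ gives a feasible periodic schedule of $I$.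
   Context: Periodic schedules: a schedule assigns to each job $J_i$ integers $u_i,v_i$ with $0\le u_i$, $u_i+p_i\le w$, $0\le v_i<B_{\pi_i}$; the start offset is $s_i=u_i+v_iw$, and the occurrences of $J_i$ are the intervals $[s_i+kT_{\pi_i},s_i+kT_{\pi_i}+p_i)$, $k\ge 0$ integer. The schedule is feasible if no occurrences of two distinct jobs intersect. Packings: a packing of $\phi(I)$ assigns to each rectangle $R_i$ integer bottom-left coordinates $(x_i,y_i)$; it is feasible if $x_i\ge 0$, $y_i\ge0$, $x_i+\ell_i\le w$, $y_i+h_i\le H$ for all $i$, and no two distinct rectangles overlap (overlap of $R_i,R_j$ meaning $x_i-\ell_j<x_j<x_i+\ell_i$ and $y_i-h_j<y_j<y_i+h_i$); it is height-divisible if $y_i$ is divisible by $h_i$ for all $i$. Mixed radix and flip: every integer $0\le y<H$ is uniquely $y=\sum_{m=1}^{r-1}y_mB_{m-1}$ with $0\le y_m<b_m$. For $0\le k\le r-1$, $\mathrm{bflip}(\mathbf b,k)=(b_k,\dots,b_1,b_{k+1},\dots,b_{r-1})$, and $\mathrm{flip}(y,k,\mathbf b)=y_k+y_{k-1}b_k+y_{k-2}b_kb_{k-1}+\dots+y_1(b_2\cdots b_k)+\sum_{m=k+1}^{r-1}y_mB_{m-1}$, i.e. the number whose digits with respect to $\mathrm{bflip}(\mathbf b,k)$ are $y_k,\dots,y_1,y_{k+1},\dots,y_{r-1}$ (least significant first); for another base vector $\mathbf c$ of the same product, $\mathrm{flip}(\cdot,k,\mathbf c)$ is defined identically using digits with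 respect to $\mathbf c$ (for $k=0$, flip is the identity). -}

module Defs where

open import Data.Nat using (ℕ; zero; suc; _+_; _*_; _≤_; _<_)
open import Data.Nat.DivMod using (_/_; _%_)
open import Data.Nat.Divisibility using (_∣_)
open import Data.List using (List; []; _∷_; length; take; drop; reverse; _++_)
open import Data.Nat.ListAction using (product)
open import Data.Fin using (Fin; toℕ)
open import Data.Product using (Σ; ∃; _×_)
open import Relation.Binary.PropositionalEquality using (_≢_)
open import Relation.Nullary using (¬_)

-- total division / remainder (value for divisor 0 is irrelevant; all
-- divisors used below are products of integers ≥ 2)
_div_ : ℕ → ℕ → ℕ
m div zero = zero
m div suc d = m / suc d

_mod_ : ℕ → ℕ → ℕ
m mod zero = m
m mod suc d = m % suc d

B : List ℕ → ℕ → ℕ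
B c k = product (take k c)

-- mixed radix digits of y w.r.t. base vector c (least significant first):
-- y = Σ_m y_m B_{m-1} with 0 ≤ y_m < c_m   (for 0 ≤ y < product c)
digits : List ℕ → ℕ → List ℕ
digits [] y = []
digits (c ∷ cs) y = (y mod c) ∷ digits cs (y div c)

fromDigits : List ℕ → List ℕ → ℕ
fromDigits _ [] = zero
fromDigits [] (d ∷ ds) = d
fromDigits (c ∷ cs) (d ∷ ds) = d + c * fromDigits cs ds

bflip : List ℕ → ℕ → List ℕ
bflip c k = reverse (take k c) ++ drop k c

flip : ℕ → ℕ → List ℕ → ℕ
flip y k c = fromDigits (bflip c k) (reverse (take k (digits c y)) ++ drop k (digits c y))

-- Instance data: T0 = w, base vector bs = (b_1,…,b_{r-1}), so r = 1 + length bs,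
-- T_k = T0 · B_k ; n jobs with processing times p and period indices π.

module Instance (T0 : ℕ) (bs : List ℕ) (n : ℕ)
                (p : Fin n → ℕ) (π : Fin n → Fin (suc (length bs))) where

  w : ℕ
  w = T0

  T : ℕ → ℕ
  T k = T0 * B bs k

  H : ℕ
  H = B bs (length bs)

  πn : Fin n → ℕ
  πn i = toℕ (π i)

  ℓ : Fin n → ℕ
  ℓ i = p i

  h : Fin n → ℕ
  h i = H div B bs (πn i)

  IsSchedule : (Fin n → ℕ) → (Fin n → ℕ) → Set
  IsSchedule u v = ∀ i → (u i + p i ≤ w) × (v i < B bs (πn i))

  start : (Fin n → ℕ) → (Fin n → ℕ) → Fin n → ℕ
  start u v i = u i + v i * w

  Occupies : (Fin n → ℕ) → (Fin n → ℕ) → Fin n → ℕ → Set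
  Occupies u v i t = ∃ λ k → (start u v i + k * T (πn i) ≤ t)
                            × (t < start u v i + k * T (πn i) + p i)

  FeasibleSchedule : (Fin n → ℕ) → (Fin n → ℕ) → Set
  FeasibleSchedule u v = IsSchedule u v
    × (∀ i j → i ≢ j → ∀ t → ¬ (Occupies u v i t × Occupies u v j t))

  Overlap : (Fin n → ℕ) → (Fin n → ℕ) → Fin n → Fin n → Set
  Overlap x y i j = (x i < x j + ℓ j) × (x j < x i + ℓ i)
                  × (y i < y j + h j) × (y j < y i + h i)

  FeasiblePacking : (Fin n → ℕ) → (Fin n → ℕ) → Set
  FeasiblePacking x y = (∀ i → (x i + ℓ i ≤ w) × (y i + h i ≤ H))
    × (∀ i j → i ≢ j → ¬ Overlap x y i j)

  HeightDivisible : (Fin n → ℕ) → Set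
  HeightDivisible y = ∀ i → h i ∣ y i

-- Lay time out in rows of length w: time t is column t mod w of row t div w. Job i then
-- occupies columns [u_i, u_i + p_i) of exactly those rows that are ≡ v_i modulo B_{π_i}, so
-- two jobs with π_i ≤ π_j (hence B_{π_i} ∣ B_{π_j}) collide iff their column intervals meet
-- and v_j ≡ v_i (mod B_{π_i}).  On v < B_k, flip(v, k, b) reverses the k mixed-radix digits
-- of v; call this f_i for job i.  Rectangle i occupies the aligned block [h_i f_i, h_i f_i + h_i)
-- with h_i = M h_j, M = b_{π_i+1} ⋯ b_{π_j}, so the y-ranges meet iff f_j div M = f_i.  Reversing
-- the longer prefix of digits and then dividing by M reverses the shorter prefix, and digit
-- reversal is injective modulo B_{π_i}, so this is again v_j ≡ v_i (mod B_{π_i}).  Hence a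
-- rectangle overlap is the same as a collision; for (ii) note that flipping w.r.t. bflip(b, k)
-- inverts flipping w.r.t. b.

module Submission where

open import Defs
open import Data.Nat
open import Data.Nat.Properties
open import Data.Nat.DivMod
  using (m≡m%n+[m/n]*n; m%n<n; [m+kn]%n≡m%n; m<n⇒m%n≡m; n%1≡0; n/1≡n; m/n/o≡m/[n*o];
         m<n*o⇒m/o<n; +-distrib-/-∣ʳ; m<n⇒m/n≡0; m*n/n≡m; m∣n⇒o%n%m≡o%m; m*[n/m]≡n)
open import Data.Nat.Divisibility using (_∣_; divides-refl; m∣m*n)
open import Data.Nat.ListAction using (product)
open import Data.Nat.ListAction.Properties using (product-++; product-↭)
open import Data.Nat.Tactic.RingSolver using (solve-∀)
open import Data.List using (List; []; _∷_; length; take; drop; reverse; _++_)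
open import Data.List.Properties
  using (take-[]; reverse-++; reverse-involutive; length-reverse; length-take; take++drop≡id; drop-drop; take-all)
open import Data.List.Relation.Unary.All as All using (All; []; _∷_)
open import Data.List.Relation.Unary.All.Properties using (++⁺; take⁺; drop⁺)
open import Data.List.Relation.Binary.Pointwise using (Pointwise; []; _∷_; reverse⁺)
open import Data.List.Relation.Binary.Permutation.Propositional using (↭-sym)
open import Data.List.Relation.Binary.Permutation.Propositional.Properties using (↭-reverse; All-resp-↭)
open import Data.Fin using (Fin)
open import Data.Fin.Properties using (toℕ≤pred[n])
open import Data.Product using (_×_; _,_; proj₁; proj₂; ∃; ∃-syntax; map₁)
open import Data.Sum using (inj₁; inj₂)
open import Function.Bundles using (_⇔_; mk⇔; Equivalence)
open import Function.Construct.Identity using (⇔-id)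
open import Function.Construct.Symmetry using (⇔-sym)
open import Function.Related.Propositional using (module EquationalReasoning)
open import Data.Product.Function.NonDependent.Propositional using (_×-⇔_)
open import Relation.Binary.PropositionalEquality
open import Relation.Nullary using (¬_)

-- Total division and remainder

mod+div : ∀ m {d} → 0 < d → m ≡ m mod d + d * (m div d)
mod+div m {suc d} _ = trans (m≡m%n+[m/n]*n m (suc d)) (cong (m % suc d +_) (*-comm (m / suc d) (suc d)))

mod-< : ∀ m {d} → 0 < d → m mod d < d
mod-< m {suc d} _ = m%n<n m (suc d)

mod-small : ∀ {a d} → a < d → a mod d ≡ a
mod-small {d = suc d} = m<n⇒m%n≡m

mod-+-multiple : ∀ a {d} q → 0 < d → (a + d * q) mod d ≡ a mod d
mod-+-multiple a {suc d} q _ = trans (cong (λ z → (a + z) % suc d) (*-comm (suc d) q)) ([m+kn]%n≡m%n a q (suc d))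

mod-unique : ∀ {a d} q → a < d → (a + d * q) mod d ≡ a
mod-unique {a} {suc d} q a<d = trans (mod-+-multiple a q (s≤s z≤n)) (mod-small a<d)

div-unique : ∀ {a d} q → a < d → (a + d * q) div d ≡ q
div-unique {a} {suc d} q a<d = begin
  (a + suc d * q) / suc d         ≡⟨ cong (λ z → (a + z) / suc d) (*-comm (suc d) q) ⟩
  (a + q * suc d) / suc d         ≡⟨ +-distrib-/-∣ʳ a (divides-refl q) ⟩
  a / suc d + q * suc d / suc d   ≡⟨ cong₂ _+_ (m<n⇒m/n≡0 a<d) (m*n/n≡m q (suc d)) ⟩
  q                               ∎
  where open ≡-Reasoning

div-div : ∀ m {a b} → 0 < a → 0 < b → (m div a) div b ≡ m div (a * b)
div-div m {suc a} {suc b} _ _ = m/n/o≡m/[n*o] m (suc a) (suc b)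

div-< : ∀ {m d q} → 0 < d → m < d * q → m div d < q
div-< {m} {suc d} {q} _ m<dq = m<n*o⇒m/o<n (subst (m <_) (*-comm (suc d) q) m<dq)

mod-mod-* : ∀ r {a b} → 0 < a → 0 < b → (r mod (a * b)) mod a ≡ r mod a
mod-mod-* r {suc a} {suc b} _ _ = m∣n⇒o%n%m≡o%m (suc a) (suc a * suc b) r (m∣m*n (suc b))

*-div-exact : ∀ {d m} → 0 < d → d ∣ m → d * (m div d) ≡ m
*-div-exact {suc d} _ = m*[n/m]≡n

bounds⇔div≡ : ∀ {M f g} → 0 < M → (M * f ≤ g × g < M * f + M) ⇔ g div M ≡ f
bounds⇔div≡ {M} {f} {g} M>0 = mk⇔ to from
  where
  to : M * f ≤ g × g < M * f + M → g div M ≡ f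
  to (lo , hi) = trans (cong (_div M) g≡) (div-unique f r<M)
    where
    r = g ∸ M * f
    g≡ : g ≡ r + M * f
    g≡ = sym (m∸n+n≡m lo)
    r<M : r < M
    r<M = +-cancelʳ-< (M * f) r M (subst₂ _<_ g≡ (+-comm (M * f) M) hi)
  from : g div M ≡ f → M * f ≤ g × g < M * f + M
  from refl = lo , hi
    where
    open ≤-Reasoning
    q = g div M
    g≡ : g ≡ g mod M + M * q
    g≡ = mod+div g M>0
    lo : M * q ≤ g
    lo = begin
      M * q             ≤⟨ m≤n+m (M * q) (g mod M) ⟩
      g mod M + M * q   ≡⟨ g≡ ⟨
      g                 ∎
    hi : g < M * q + M
    hi = begin-strict
      g                 ≡⟨ g≡ ⟩
      g mod M + M * q   <⟨ +-monoˡ-< (M * q) (mod-< g M>0) ⟩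
      M + M * q         ≡⟨ +-comm M (M * q) ⟩
      M * q + M         ∎

-- Intervals, aligned blocks and periodic occurrences

*-cancelˡ-<⇔ : ∀ {d m n} → 0 < d → d * m < d * n ⇔ m < n
*-cancelˡ-<⇔ {suc d} {m} {n} _ = mk⇔ (*-cancelˡ-< (suc d) m n) (*-monoʳ-< (suc d))

aligned-blocks-overlap⇔div≡ : ∀ {M D f g} → 0 < M → 0 < D →
  (M * D * f < D * g + D × D * g < M * D * f + M * D) ⇔ g div M ≡ f
aligned-blocks-overlap⇔div≡ {M} {D} {f} {g} M>0 D>0 = begin
  (M * D * f < D * g + D × D * g < M * D * f + M * D)
    ≡⟨ cong₂ _×_ (cong₂ _<_ (e₁ M D f) (e₂ D g)) (cong (D * g <_) (e₃ M D f)) ⟩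
  (D * (M * f) < D * suc g × D * g < D * (M * f + M))
    ∼⟨ *-cancelˡ-<⇔ D>0 ×-⇔ *-cancelˡ-<⇔ D>0 ⟩
  (M * f < suc g × g < M * f + M)
    ∼⟨ mk⇔ (map₁ m<1+n⇒m≤n) (map₁ s≤s) ⟩
  (M * f ≤ g × g < M * f + M)
    ∼⟨ bounds⇔div≡ M>0 ⟩
  g div M ≡ f ∎
  where
  open EquationalReasoning
  e₁ : ∀ M D f → M * D * f ≡ D * (M * f)
  e₁ = solve-∀
  e₂ : ∀ D g → D * g + D ≡ D * suc g
  e₂ = solve-∀
  e₃ : ∀ M D f → M * D * f + M * D ≡ D * (M * f + M)
  e₃ = solve-∀

intervals-overlap⇔common-point : ∀ {a p b q} → 0 < p → 0 < q →
  (a < b + q × b < a + p) ⇔ (∃[ c ] (a ≤ c × c < a + p) × (b ≤ c × c < b + q))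
intervals-overlap⇔common-point {a} {p} {b} {q} p>0 q>0 = mk⇔ to from
  where
  to : a < b + q × b < a + p → ∃[ c ] (a ≤ c × c < a + p) × (b ≤ c × c < b + q)
  to (a<b+q , b<a+p) = a ⊔ b , (m≤m⊔n a b , ⊔-lub (m<m+n a p>0) b<a+p)
                             , (m≤n⊔m a b , ⊔-lub a<b+q (m<m+n b q>0))
  from : ∃[ c ] (a ≤ c × c < a + p) × (b ≤ c × c < b + q) → a < b + q × b < a + p
  from (c , (a≤c , c<a+p) , (b≤c , c<b+q)) = ≤-<-trans a≤c c<b+q , ≤-<-trans b≤c c<a+p

row-of-time : ∀ {w u p A t} → u + p ≤ w → u + w * A ≤ t → t < u + w * A + p →
  t div w ≡ A × (u ≤ t mod w × t mod w < u + p)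
row-of-time {w} {u} {p} {A} {t} u+p≤w lo hi =
  row , subst (u ≤_) (sym col) u≤c , subst (_< u + p) (sym col) c<u+p
  where
  c = t ∸ w * A
  t≡ : t ≡ c + w * A
  t≡ = sym (m∸n+n≡m (≤-trans (m≤n+m (w * A) u) lo))
  u≤c : u ≤ c
  u≤c = +-cancelʳ-≤ (w * A) u c (subst (u + w * A ≤_) t≡ lo)
  rearrange : ∀ u x p → u + x + p ≡ u + p + x
  rearrange = solve-∀
  c<u+p : c < u + p
  c<u+p = +-cancelʳ-< (w * A) c (u + p) (subst₂ _<_ t≡ (rearrange u (w * A) p) hi)
  c<w : c < w
  c<w = <-≤-trans c<u+p u+p≤w
  row : t div w ≡ A
  row = trans (cong (_div w) t≡) (div-unique A c<w)
  col : t mod w ≡ c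
  col = trans (cong (_mod w) t≡) (mod-unique A c<w)

occurrence⇔column×row : ∀ {w a u v p t} → 0 < w → u + p ≤ w → v < a →
  (∃ λ k → u + v * w + k * (w * a) ≤ t × t < u + v * w + k * (w * a) + p)
  ⇔ ((u ≤ t mod w × t mod w < u + p) × (t div w) mod a ≡ v)
occurrence⇔column×row {w} {a} {u} {v} {p} {t} w>0 u+p≤w v<a = mk⇔ to from
  where
  shift : ∀ u v w a k → u + v * w + k * (w * a) ≡ u + w * (v + a * k)
  shift = solve-∀
  start≡ : ∀ k → u + v * w + k * (w * a) ≡ u + w * (v + a * k)
  start≡ = shift u v w a
  to : (∃ λ k → u + v * w + k * (w * a) ≤ t × t < u + v * w + k * (w * a) + p) →
       (u ≤ t mod w × t mod w < u + p) × (t div w) mod a ≡ v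
  to (k , lo , hi) with row-of-time u+p≤w (subst (_≤ t) (start≡ k) lo) (subst (λ s → t < s + p) (start≡ k) hi)
  ... | row , col = col , trans (cong (_mod a) row) (mod-unique k v<a)
  from : (u ≤ t mod w × t mod w < u + p) × (t div w) mod a ≡ v →
         ∃ λ k → u + v * w + k * (w * a) ≤ t × t < u + v * w + k * (w * a) + p
  from ((u≤c , c<u+p) , row≡v) = K , lo , hi
    where
    open ≤-Reasoning
    K = (t div w) div a
    X = w * (v + a * K)
    t≡ : t ≡ t mod w + X
    t≡ = trans (mod+div t w>0)
           (cong (λ r → t mod w + w * r)
                 (trans (mod+div (t div w) (≤-trans (s≤s z≤n) v<a)) (cong (_+ a * K) row≡v)))
    lo : u + v * w + K * (w * a) ≤ t
    lo = begin
      u + v * w + K * (w * a)  ≡⟨ start≡ K ⟩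
      u + X                    ≤⟨ +-monoˡ-≤ X u≤c ⟩
      t mod w + X              ≡⟨ t≡ ⟨
      t                        ∎
    rearrange : ∀ u p x → u + p + x ≡ u + x + p
    rearrange = solve-∀
    hi : t < u + v * w + K * (w * a) + p
    hi = begin-strict
      t                        ≡⟨ t≡ ⟩
      t mod w + X              <⟨ +-monoˡ-< X c<u+p ⟩
      u + p + X                ≡⟨ rearrange u p X ⟩
      u + X + p                ≡⟨ cong (_+ p) (start≡ K) ⟨
      u + v * w + K * (w * a) + p ∎

-- Mixed-radix digits and their reversal

Positive : List ℕ → Set
Positive = All (0 <_)

product-positive : ∀ {cs} → Positive cs → 0 < product cs
product-positive []           = s≤s z≤n
product-positive (c>0 ∷ cs>0) = *-mono-< c>0 (product-positive cs>0)

product-reverse : ∀ cs → product (reverse cs) ≡ product cs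
product-reverse cs = product-↭ (↭-reverse cs)

positive-reverse : ∀ {cs} → Positive cs → Positive (reverse cs)
positive-reverse {cs} = All-resp-↭ (↭-sym (↭-reverse cs))

d+c*f<c*p : ∀ {d c f p} → d < c → f < p → d + c * f < c * p
d+c*f<c*p {d} {c} {f} {p} d<c f<p = begin-strict
  d + c * f  <⟨ +-monoˡ-< (c * f) d<c ⟩
  c + c * f  ≡⟨ *-suc c f ⟨
  c * suc f  ≤⟨ *-monoʳ-≤ c f<p ⟩
  c * p      ∎
  where open ≤-Reasoning

length-digits : ∀ cs v → length (digits cs v) ≡ length cs
length-digits []       v = refl
length-digits (c ∷ cs) v = cong suc (length-digits cs (v div c))

digits-< : ∀ {cs} v → Positive cs → Pointwise _<_ (digits cs v) cs
digits-< v []                    = []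
digits-< {c ∷ cs} v (c>0 ∷ cs>0) = mod-< v c>0 ∷ digits-< (v div c) cs>0

fromDigits-< : ∀ {ds cs} → Pointwise _<_ ds cs → fromDigits cs ds < product cs
fromDigits-< []            = s≤s z≤n
fromDigits-< (d<c ∷ ds<cs) = d+c*f<c*p d<c (fromDigits-< ds<cs)

digits-fromDigits : ∀ {ds cs} → Pointwise _<_ ds cs → digits cs (fromDigits cs ds) ≡ ds
digits-fromDigits [] = refl
digits-fromDigits {d ∷ ds} {c ∷ cs} (d<c ∷ ds<cs) =
  cong₂ _∷_ (mod-unique (fromDigits cs ds) d<c)
            (trans (cong (digits cs) (div-unique (fromDigits cs ds) d<c)) (digits-fromDigits ds<cs))

fromDigits-digits : ∀ {cs} v → Positive cs → fromDigits cs (digits cs v) ≡ v mod product cs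
fromDigits-digits v [] = sym (n%1≡0 v)
fromDigits-digits {c ∷ cs} v (c>0 ∷ cs>0) = begin
  r + c * fromDigits cs (digits cs (v div c))  ≡⟨ cong (λ z → r + c * z) (fromDigits-digits (v div c) cs>0) ⟩
  r + c * s                                     ≡⟨ mod-unique q r+cs<cP ⟨
  (r + c * s + (c * P) * q) mod (c * P)         ≡⟨ cong (_mod (c * P)) v≡ ⟨
  v mod (c * P)                                 ∎
  where
  open ≡-Reasoning
  P = product cs
  r = v mod c
  s = (v div c) mod P
  q = (v div c) div P
  regroup : ∀ r c s P q → r + c * (s + P * q) ≡ r + c * s + (c * P) * q
  regroup = solve-∀
  v≡ : v ≡ r + c * s + (c * P) * q
  v≡ = trans (mod+div v c>0)
         (trans (cong (λ z → r + c * z) (mod+div (v div c) (product-positive cs>0))) (regroup r c s P q))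
  r+cs<cP : r + c * s < c * P
  r+cs<cP = d+c*f<c*p (mod-< v c>0) (mod-< (v div c) (product-positive cs>0))

digits-mod : ∀ {cs} v → Positive cs → digits cs (v mod product cs) ≡ digits cs v
digits-mod {cs} v cs>0 =
  trans (cong (digits cs) (sym (fromDigits-digits v cs>0))) (digits-fromDigits (digits-< v cs>0))

fromDigits-++ : ∀ cs ds ms es → length cs ≡ length ds →
  fromDigits (cs ++ ms) (ds ++ es) ≡ fromDigits cs ds + product cs * fromDigits ms es
fromDigits-++ []       []       ms es _ = sym (+-identityʳ (fromDigits ms es))
fromDigits-++ (c ∷ cs) (d ∷ ds) ms es eq =
  trans (cong (λ z → d + c * z) (fromDigits-++ cs ds ms es (suc-injective eq)))
        (distrib d c (fromDigits cs ds) (product cs) (fromDigits ms es))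
  where
  distrib : ∀ d c a b e → d + c * (a + b * e) ≡ d + c * a + c * b * e
  distrib = solve-∀

digits-++ : ∀ {cs} ms v → Positive cs → digits (cs ++ ms) v ≡ digits cs v ++ digits ms (v div product cs)
digits-++ ms v [] = cong (digits ms) (sym (n/1≡n v))
digits-++ {c ∷ cs} ms v (c>0 ∷ cs>0) = cong (v mod c ∷_)
  (trans (digits-++ ms (v div c) cs>0)
         (cong (λ z → digits cs (v div c) ++ digits ms z) (div-div v c>0 (product-positive cs>0))))

take-digits : ∀ k cs v → take k (digits cs v) ≡ digits (take k cs) v
take-digits zero    cs       v = refl
take-digits (suc k) []       v = refl
take-digits (suc k) (c ∷ cs) v = cong (v mod c ∷_) (take-digits k cs (v div c))

drop-digits : ∀ k {cs} v → Positive cs → v < B cs k → drop k (digits cs v) ≡ digits (drop k cs) 0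
drop-digits zero    v _ v<1 rewrite n<1⇒n≡0 v<1 = refl
drop-digits (suc k) {[]}     v _ _ = refl
drop-digits (suc k) {c ∷ cs} v (c>0 ∷ cs>0) v<cB = drop-digits k (v div c) cs>0 (div-< c>0 v<cB)

digitReverse : List ℕ → ℕ → ℕ
digitReverse cs v = fromDigits (reverse cs) (reverse (digits cs v))

length-reverse-digits : ∀ cs v → length (reverse cs) ≡ length (reverse (digits cs v))
length-reverse-digits cs v =
  trans (length-reverse cs) (sym (trans (length-reverse (digits cs v)) (length-digits cs v)))

flip≡digitReverse : ∀ k {cs} v → Positive cs → v < B cs k → flip v k cs ≡ digitReverse (take k cs) v
flip≡digitReverse k {cs} v cs>0 v<B = begin
  fromDigits (reverse (take k cs) ++ drop k cs) (reverse (take k (digits cs v)) ++ drop k (digits cs v))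
    ≡⟨ cong₂ (λ ds es → fromDigits (reverse (take k cs) ++ drop k cs) (reverse ds ++ es))
             (take-digits k cs v) (drop-digits k v cs>0 v<B) ⟩
  fromDigits (reverse (take k cs) ++ drop k cs) (reverse (digits (take k cs) v) ++ digits (drop k cs) 0)
    ≡⟨ fromDigits-++ (reverse (take k cs)) (reverse (digits (take k cs) v)) (drop k cs) (digits (drop k cs) 0)
                     (length-reverse-digits (take k cs) v) ⟩
  digitReverse (take k cs) v + product (reverse (take k cs)) * fromDigits (drop k cs) (digits (drop k cs) 0)
    ≡⟨ cong (λ z → digitReverse (take k cs) v + product (reverse (take k cs)) * z) tail≡0 ⟩
  digitReverse (take k cs) v + product (reverse (take k cs)) * 0
    ≡⟨ cong (digitReverse (take k cs) v +_) (*-zeroʳ (product (reverse (take k cs)))) ⟩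
  digitReverse (take k cs) v + 0
    ≡⟨ +-identityʳ _ ⟩
  digitReverse (take k cs) v ∎
  where
  open ≡-Reasoning
  tail≡0 : fromDigits (drop k cs) (digits (drop k cs) 0) ≡ 0
  tail≡0 = trans (fromDigits-digits 0 (drop⁺ k cs>0)) (mod-small (product-positive (drop⁺ k cs>0)))

digitReverse-< : ∀ {cs} v → Positive cs → digitReverse cs v < product cs
digitReverse-< {cs} v cs>0 =
  subst (digitReverse cs v <_) (product-reverse cs) (fromDigits-< (reverse⁺ (digits-< v cs>0)))

digitReverse-involutive : ∀ {cs} v → Positive cs →
  digitReverse (reverse cs) (digitReverse cs v) ≡ v mod product cs
digitReverse-involutive {cs} v cs>0
  rewrite digits-fromDigits (reverse⁺ (digits-< v cs>0)) | reverse-involutive (digits cs v) | reverse-involutive cs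
  = fromDigits-digits v cs>0

digitReverse-++ : ∀ {cs} ms v → Positive cs →
  digitReverse (cs ++ ms) v ≡ digitReverse ms (v div product cs) + product ms * digitReverse cs v
digitReverse-++ {cs} ms v cs>0
  rewrite digits-++ ms v cs>0 | reverse-++ cs ms | reverse-++ (digits cs v) (digits ms (v div product cs))
        | fromDigits-++ (reverse ms) (reverse (digits ms (v div product cs))) (reverse cs) (reverse (digits cs v))
                        (length-reverse-digits ms (v div product cs))
        | product-reverse ms
  = refl

digitReverse-++-div : ∀ {cs ms} v → Positive cs → Positive ms →
  digitReverse (cs ++ ms) v div product ms ≡ digitReverse cs v
digitReverse-++-div {cs} {ms} v cs>0 ms>0 =
  trans (cong (_div product ms) (digitReverse-++ ms v cs>0)) (div-unique _ (digitReverse-< _ ms>0))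

digitReverse≡⇔mod≡ : ∀ {cs} a b → Positive cs →
  digitReverse cs a ≡ digitReverse cs b ⇔ a mod product cs ≡ b mod product cs
digitReverse≡⇔mod≡ {cs} a b cs>0 = mk⇔
  (λ eq → trans (sym (digitReverse-involutive a cs>0))
            (trans (cong (digitReverse (reverse cs)) eq) (digitReverse-involutive b cs>0)))
  (λ eq → trans (sym (digitReverse-mod a)) (trans (cong (digitReverse cs) eq) (digitReverse-mod b)))
  where
  digitReverse-mod : ∀ v → digitReverse cs (v mod product cs) ≡ digitReverse cs v
  digitReverse-mod v = cong (λ ds → fromDigits (reverse cs) (reverse ds)) (digits-mod v cs>0)

-- Prefixes and suffixes of the base vector

take-+ : ∀ {A : Set} m d (xs : List A) → take (m + d) xs ≡ take m xs ++ take d (drop m xs)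
take-+ zero    d xs       = refl
take-+ (suc m) d []       = sym (take-[] d)
take-+ (suc m) d (x ∷ xs) = cong (x ∷_) (take-+ m d xs)

take-length-++ : ∀ {A : Set} (xs ys : List A) → take (length xs) (xs ++ ys) ≡ xs
take-length-++ []       ys = refl
take-length-++ (x ∷ xs) ys = cong (x ∷_) (take-length-++ xs ys)

take-bflip : ∀ k cs → k ≤ length cs → take k (bflip cs k) ≡ reverse (take k cs)
take-bflip k cs k≤ =
  trans (cong (λ z → take z (bflip cs k)) (sym length≡k)) (take-length-++ (reverse (take k cs)) (drop k cs))
  where
  length≡k : length (reverse (take k cs)) ≡ k
  length≡k = trans (length-reverse (take k cs)) (trans (length-take k cs) (m≤n⇒m⊓n≡m k≤))

product-take-drop : ∀ k cs → product cs ≡ product (take k cs) * product (drop k cs)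
product-take-drop k cs = trans (cong product (sym (take++drop≡id k cs))) (product-++ (take k cs) (drop k cs))

m*n+m≤m*o⇔n<o : ∀ {h f b} → 0 < h → (h * f + h ≤ h * b) ⇔ f < b
m*n+m≤m*o⇔n<o {suc h} {f} {b} _ = mk⇔
  (λ le → *-cancelˡ-≤ (suc h) (subst (_≤ suc h * b) (rearrange f) le))
  (λ lt → subst (_≤ suc h * b) (sym (rearrange f)) (*-monoʳ-≤ (suc h) lt))
  where
  rearrange : ∀ f → suc h * f + suc h ≡ suc h * suc f
  rearrange f = trans (+-comm (suc h * f) (suc h)) (sym (*-suc (suc h) f))

module Correspondence (T0 : ℕ) (T0>0 : 0 < T0) (bs : List ℕ) (bs>0 : Positive bs)
    (n : ℕ) (p : Fin n → ℕ) (p>0 : ∀ i → 0 < p i)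
    (π : Fin n → Fin (suc (length bs))) where
  open Instance T0 bs n p π

  prefix : Fin n → List ℕ
  prefix i = take (πn i) bs

  prefix>0 : ∀ i → Positive (prefix i)
  prefix>0 i = take⁺ (πn i) bs>0

  B>0 : ∀ k → 0 < B bs k
  B>0 k = product-positive (take⁺ k bs>0)

  height : ℕ → ℕ
  height k = product (drop k bs)

  height>0 : ∀ k → 0 < height k
  height>0 k = product-positive (drop⁺ k bs>0)

  H≡B*height : ∀ k → H ≡ B bs k * height k
  H≡B*height k = trans (cong product (take-all (length bs) bs ≤-refl)) (product-take-drop k bs)

  h≡height : ∀ i → h i ≡ height (πn i)
  h≡height i = trans (cong (_div B bs (πn i)) (H≡B*height (πn i))) (div-unique (height (πn i)) (B>0 (πn i)))

  h>0 : ∀ i → 0 < h i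
  h>0 i = subst (0 <_) (sym (h≡height i)) (height>0 (πn i))

  H≡h*B : ∀ i → H ≡ h i * B bs (πn i)
  H≡h*B i = trans (H≡B*height (πn i))
    (trans (*-comm (B bs (πn i)) (height (πn i))) (cong (_* B bs (πn i)) (sym (h≡height i))))

  height-fits⇔ : ∀ i f → (h i * f + h i ≤ H) ⇔ f < B bs (πn i)
  height-fits⇔ i f =
    subst (λ z → (h i * f + h i ≤ z) ⇔ f < B bs (πn i)) (sym (H≡h*B i)) (m*n+m≤m*o⇔n<o (h>0 i))

  segment : ℕ → ℕ → List ℕ
  segment k l = take (l ∸ k) (drop k bs)

  segment>0 : ∀ k l → Positive (segment k l)
  segment>0 k l = take⁺ (l ∸ k) (drop⁺ k bs>0)

  take-segment : ∀ {k l} → k ≤ l → take l bs ≡ take k bs ++ segment k l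
  take-segment {k} {l} k≤l = trans (cong (λ z → take z bs) (sym (m+[n∸m]≡n k≤l))) (take-+ k (l ∸ k) bs)

  B-segment : ∀ {k l} → k ≤ l → B bs l ≡ B bs k * product (segment k l)
  B-segment {k} {l} k≤l = trans (cong product (take-segment k≤l)) (product-++ (take k bs) (segment k l))

  height-segment : ∀ {k l} → k ≤ l → height k ≡ product (segment k l) * height l
  height-segment {k} {l} k≤l = trans (product-take-drop (l ∸ k) (drop k bs))
    (cong (λ z → product (segment k l) * product z)
          (trans (drop-drop k (l ∸ k) bs) (cong (λ z → drop z bs) (m+[n∸m]≡n k≤l))))

  Collide : (u v : Fin n → ℕ) → Fin n → Fin n → Set
  Collide u v i j = ∃ λ t → Occupies u v i t × Occupies u v j t

  collide-swap : ∀ {u v i j} → Collide u v i j ⇔ Collide u v j i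
  collide-swap = mk⇔ (λ (t , oᵢ , oⱼ) → t , oⱼ , oᵢ) (λ (t , oⱼ , oᵢ) → t , oᵢ , oⱼ)

  overlap-swap : ∀ {x y i j} → Overlap x y i j ⇔ Overlap x y j i
  overlap-swap = mk⇔ (λ (a , b , c , d) → b , a , d , c) (λ (a , b , c , d) → b , a , d , c)

  module _ {u v y : Fin n → ℕ} (sched : IsSchedule u v)
           (y≡ : ∀ i → y i ≡ h i * digitReverse (prefix i) (v i)) where

    occupies⇔ : ∀ i t → Occupies u v i t ⇔
      ((u i ≤ t mod w × t mod w < u i + p i) × (t div w) mod B bs (πn i) ≡ v i)
    occupies⇔ i t = occurrence⇔column×row T0>0 (proj₁ (sched i)) (proj₂ (sched i))

    rows-overlap⇔mod≡ : ∀ {i j} → πn i ≤ πn j →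
      (y i < y j + h j × y j < y i + h i) ⇔ v j mod B bs (πn i) ≡ v i
    rows-overlap⇔mod≡ {i} {j} le = begin
      (y i < y j + h j × y j < y i + h i)
        ≡⟨ cong₂ _×_ (cong₂ _<_ yᵢ≡ (cong₂ _+_ yⱼ≡ hⱼ≡)) (cong₂ _<_ yⱼ≡ (cong₂ _+_ yᵢ≡ hᵢ≡)) ⟩
      (M * D * fᵢ < D * fⱼ + D × D * fⱼ < M * D * fᵢ + M * D)
        ∼⟨ aligned-blocks-overlap⇔div≡ (product-positive (segment>0 (πn i) (πn j))) (height>0 (πn j)) ⟩
      fⱼ div M ≡ fᵢ
        ≡⟨ cong (_≡ fᵢ) fⱼ/M≡ ⟩
      digitReverse (prefix i) (v j) ≡ fᵢ
        ∼⟨ digitReverse≡⇔mod≡ (v j) (v i) (prefix>0 i) ⟩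
      v j mod B bs (πn i) ≡ v i mod B bs (πn i)
        ≡⟨ cong (v j mod B bs (πn i) ≡_) (mod-small (proj₂ (sched i))) ⟩
      v j mod B bs (πn i) ≡ v i ∎
      where
      open EquationalReasoning
      M = product (segment (πn i) (πn j))
      D = height (πn j)
      fᵢ = digitReverse (prefix i) (v i)
      fⱼ = digitReverse (prefix j) (v j)
      hᵢ≡ : h i ≡ M * D
      hᵢ≡ = trans (h≡height i) (height-segment le)
      hⱼ≡ : h j ≡ D
      hⱼ≡ = h≡height j
      yᵢ≡ : y i ≡ M * D * fᵢ
      yᵢ≡ = trans (y≡ i) (cong (_* fᵢ) hᵢ≡)
      yⱼ≡ : y j ≡ D * fⱼ
      yⱼ≡ = trans (y≡ j) (cong (_* fⱼ) hⱼ≡)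
      fⱼ/M≡ : fⱼ div M ≡ digitReverse (prefix i) (v j)
      fⱼ/M≡ = trans (cong (λ cs → digitReverse cs (v j) div M) (take-segment le))
                    (digitReverse-++-div (v j) (prefix>0 i) (segment>0 (πn i) (πn j)))

    collide⇔columns×mod≡ : ∀ {i j} → πn i ≤ πn j →
      Collide u v i j ⇔ (u i < u j + p j × u j < u i + p i × v j mod B bs (πn i) ≡ v i)
    collide⇔columns×mod≡ {i} {j} le = mk⇔ to from
      where
      a = B bs (πn i)
      M = product (segment (πn i) (πn j))
      to : Collide u v i j → u i < u j + p j × u j < u i + p i × v j mod a ≡ v i
      to (t , oᵢ , oⱼ) with Equivalence.to (occupies⇔ i t) oᵢ | Equivalence.to (occupies⇔ j t) oⱼ
      ... | colᵢ , rowᵢ | colⱼ , rowⱼ = proj₁ cols , proj₂ cols , row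
        where
        cols = Equivalence.from (intervals-overlap⇔common-point (p>0 i) (p>0 j)) (t mod w , colᵢ , colⱼ)
        r = t div w
        row : v j mod a ≡ v i
        row = begin
          v j mod a                  ≡⟨ cong (_mod a) rowⱼ ⟨
          (r mod B bs (πn j)) mod a  ≡⟨ cong (λ z → (r mod z) mod a) (B-segment le) ⟩
          (r mod (a * M)) mod a      ≡⟨ mod-mod-* r (B>0 (πn i)) (product-positive (segment>0 (πn i) (πn j))) ⟩
          r mod a                    ≡⟨ rowᵢ ⟩
          v i                        ∎
          where open ≡-Reasoning
      from : u i < u j + p j × u j < u i + p i × v j mod a ≡ v i → Collide u v i j
      from (c₁ , c₂ , row) with Equivalence.to (intervals-overlap⇔common-point (p>0 i) (p>0 j)) (c₁ , c₂)
      ... | c , colᵢ , colⱼ =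
        t , Equivalence.from (occupies⇔ i t) (atᵢ , rowᵢ) , Equivalence.from (occupies⇔ j t) (atⱼ , rowⱼ)
        where
        t = c + w * v j
        c<w : c < w
        c<w = <-≤-trans (proj₂ colᵢ) (proj₁ (sched i))
        t%w≡c : t mod w ≡ c
        t%w≡c = mod-unique (v j) c<w
        t/w≡v : t div w ≡ v j
        t/w≡v = div-unique (v j) c<w
        atᵢ : u i ≤ t mod w × t mod w < u i + p i
        atᵢ = subst (λ z → u i ≤ z × z < u i + p i) (sym t%w≡c) colᵢ
        atⱼ : u j ≤ t mod w × t mod w < u j + p j
        atⱼ = subst (λ z → u j ≤ z × z < u j + p j) (sym t%w≡c) colⱼ
        rowᵢ : (t div w) mod a ≡ v i
        rowᵢ = trans (cong (_mod a) t/w≡v) row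
        rowⱼ : (t div w) mod B bs (πn j) ≡ v j
        rowⱼ = trans (cong (_mod B bs (πn j)) t/w≡v) (mod-small (proj₂ (sched j)))

    overlap⇔collide-ordered : ∀ {i j} → πn i ≤ πn j → Overlap u y i j ⇔ Collide u v i j
    overlap⇔collide-ordered {i} {j} le = begin
      Overlap u y i j
        ∼⟨ ⇔-id _ ×-⇔ ⇔-id _ ×-⇔ rows-overlap⇔mod≡ le ⟩
      (u i < u j + p j × u j < u i + p i × v j mod B bs (πn i) ≡ v i)
        ∼⟨ ⇔-sym (collide⇔columns×mod≡ le) ⟩
      Collide u v i j ∎
      where open EquationalReasoning

    overlap⇔collide : ∀ i j → Overlap u y i j ⇔ Collide u v i j
    overlap⇔collide i j with ≤-total (πn i) (πn j)
    ... | inj₁ le = overlap⇔collide-ordered le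
    ... | inj₂ le = begin
      Overlap u y i j  ∼⟨ overlap-swap {u} {y} {i} {j} ⟩
      Overlap u y j i  ∼⟨ overlap⇔collide-ordered le ⟩
      Collide u v j i  ∼⟨ collide-swap {u} {v} {j} {i} ⟩
      Collide u v i j  ∎
      where open EquationalReasoning

  schedule⇒packing : ∀ u v → FeasibleSchedule u v →
    FeasiblePacking u (λ i → h i * flip (v i) (πn i) bs) × HeightDivisible (λ i → h i * flip (v i) (πn i) bs)
  schedule⇒packing u v (sched , collision-free) = (fits , disjoint) , λ i → m∣m*n (flip (v i) (πn i) bs)
    where
    f≡ : ∀ i → flip (v i) (πn i) bs ≡ digitReverse (prefix i) (v i)
    f≡ i = flip≡digitReverse (πn i) (v i) bs>0 (proj₂ (sched i))
    fits : ∀ i → (u i + ℓ i ≤ w) × (h i * flip (v i) (πn i) bs + h i ≤ H)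
    fits i = proj₁ (sched i)
           , Equivalence.from (height-fits⇔ i _)
               (subst (_< B bs (πn i)) (sym (f≡ i)) (digitReverse-< (v i) (prefix>0 i)))
    disjoint : ∀ i j → i ≢ j → ¬ Overlap u (λ i → h i * flip (v i) (πn i) bs) i j
    disjoint i j i≢j ov with Equivalence.to (overlap⇔collide sched (λ i → cong (h i *_) (f≡ i)) i j) ov
    ... | t , occupied = collision-free i j i≢j t occupied

  packing⇒schedule : ∀ x y → FeasiblePacking x y → HeightDivisible y →
    FeasibleSchedule x (λ i → flip (y i div h i) (πn i) (bflip bs (πn i)))
  packing⇒schedule x y (fits , disjoint) h∣y = sched , collision-free
    where
    f : Fin n → ℕ
    f i = y i div h i
    v : Fin n → ℕ
    v i = flip (f i) (πn i) (bflip bs (πn i))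
    y≡ : ∀ i → y i ≡ h i * f i
    y≡ i = sym (*-div-exact (h>0 i) (h∣y i))
    f< : ∀ i → f i < B bs (πn i)
    f< i = Equivalence.to (height-fits⇔ i (f i)) (subst (λ z → z + h i ≤ H) (y≡ i) (proj₂ (fits i)))
    v≡ : ∀ i → v i ≡ digitReverse (reverse (prefix i)) (f i)
    v≡ i = trans (flip≡digitReverse (πn i) (f i) bflip>0 f<′) (cong (λ cs → digitReverse cs (f i)) take≡)
      where
      take≡ : take (πn i) (bflip bs (πn i)) ≡ reverse (prefix i)
      take≡ = take-bflip (πn i) bs (toℕ≤pred[n] (π i))
      bflip>0 : Positive (bflip bs (πn i))
      bflip>0 = ++⁺ (positive-reverse (prefix>0 i)) (drop⁺ (πn i) bs>0)
      f<′ : f i < B (bflip bs (πn i)) (πn i)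
      f<′ = subst (f i <_) (sym (trans (cong product take≡) (product-reverse (prefix i)))) (f< i)
    sched : IsSchedule x v
    sched i = proj₁ (fits i)
            , subst₂ _<_ (sym (v≡ i)) (product-reverse (prefix i)) (digitReverse-< (f i) (positive-reverse (prefix>0 i)))
    f≡ : ∀ i → f i ≡ digitReverse (prefix i) (v i)
    f≡ i = sym (begin
      digitReverse (prefix i) (v i)
        ≡⟨ cong (digitReverse (prefix i)) (v≡ i) ⟩
      digitReverse (prefix i) (digitReverse (reverse (prefix i)) (f i))
        ≡⟨ cong (λ cs → digitReverse cs (digitReverse (reverse (prefix i)) (f i))) (reverse-involutive (prefix i)) ⟨
      digitReverse (reverse (reverse (prefix i))) (digitReverse (reverse (prefix i)) (f i))
        ≡⟨ digitReverse-involutive (f i) (positive-reverse (prefix>0 i)) ⟩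
      f i mod product (reverse (prefix i))
        ≡⟨ mod-small (subst (f i <_) (sym (product-reverse (prefix i))) (f< i)) ⟩
      f i ∎)
      where open ≡-Reasoning
    collision-free : ∀ i j → i ≢ j → ∀ t → ¬ (Occupies x v i t × Occupies x v j t)
    collision-free i j i≢j t occupied =
      disjoint i j i≢j (Equivalence.from (overlap⇔collide sched y≡′ i j) (t , occupied))
      where
      y≡′ : ∀ i → y i ≡ h i * digitReverse (prefix i) (v i)
      y≡′ i = trans (y≡ i) (cong (h i *_) (f≡ i))

theorem1 : (T0 : ℕ) → 0 < T0 → (bs : List ℕ) → All (2 ≤_) bs →
    (n : ℕ) (p : Fin n → ℕ) → (∀ i → 0 < p i) →
    (π : Fin n → Fin (suc (length bs))) →
    let open Instance T0 bs n p π in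
      (∀ (u v : Fin n → ℕ) → FeasibleSchedule u v →
          FeasiblePacking u (λ i → h i * flip (v i) (πn i) bs)
          × HeightDivisible (λ i → h i * flip (v i) (πn i) bs))
      × (∀ (x y : Fin n → ℕ) → FeasiblePacking x y → HeightDivisible y →
          FeasibleSchedule x (λ i → flip (y i div h i) (πn i) (bflip bs (πn i))))
theorem1 T0 T0>0 bs bs≥2 n p p>0 π = schedule⇒packing , packing⇒schedule
  where open Correspondence T0 T0>0 bs (All.map (≤-trans (s≤s z≤n)) bs≥2) n p p>0 π
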